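{- Let $r,k,J\in\mathbb{N}$ with $r>k\geq2$. There are constants $C>0$ and $\epsilon>0$ such that for all $n>r$ there is an $r$-uniform hypergraph on $n$ vertices satisfying: (1) it has at least $Cn^{k+\epsilon}$ hyperedges; (2) no two hyperedges intersect in more than $k$ vertices; (3) for every $j\leq J$, there is no set of $j$ hyperedges whose union has at most $jr-k(j-1)-1$ vertices. -}

module Defs where

open import Data.Nat using (ℕ; _≤_; _*_; _+_; _^_)
open import Data.Fin using (Fin)
open import Data.Fin.Subset using (Subset; _∩_; ∣_∣; ⋃)
open import Data.Fin.Subset.Properties using (_∈?_)
open import Data.List using (List; map; filter; allFin)
open import Relation.Binary.PropositionalEquality using (_≡_; _≢_)

record Hypergraph (n r : ℕ) : Set where
  field
    m        : ℕ
    edge     : Fin m → Subset n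
    uniform  : ∀ e → ∣ edge e ∣ ≡ r
    distinct : ∀ e f → edge e ≡ edge f → e ≡ f

open Hypergraph public

unionOf : ∀ {n r} (H : Hypergraph n r) → Subset (m H) → Subset n
unionOf H S = ⋃ (map (edge H) (filter (_∈? S) (allFin (m H))))

-- "at least C n^(k+ε) hyperedges" with C = c/d and ε = p/q (positive rationals),
-- i.e.  m ≥ (c/d) n^(k + p/q)  ⇔  (d·m)^q ≥ c^q · n^(k·q + p).
ManyEdges : ∀ {n r} → Hypergraph n r → (k c d p q : ℕ) → Set
ManyEdges {n} H k c d p q = c ^ q * n ^ (k * q + p) ≤ (d * m H) ^ q

SmallIntersections : ∀ {n r} → Hypergraph n r → ℕ → Set
SmallIntersections H k = ∀ e f → e ≢ f → ∣ edge H e ∩ edge H f ∣ ≤ k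

{-# OPTIONS --safe #-}
-- Deletion method.  Write r = k + e + 1 and q = J + 2, keep each r-subset of the
-- n vertices independently with probability 1 / t, t ≈ n ^ (e + 1 − 1 / q), and
-- call j ≤ q kept sets dense when they span at most j r − k (j − 1) − 1 vertices.
-- Such a family is fixed by its vertex span and a choice of j r-subsets inside it,
-- so dense families of size j number O(n ^ (k + e + (j − 1) (e + 1))) and on
-- average O(n ^ (k − 1 + j / q)) ≤ O(n ^ k) of them are kept, far fewer than the
-- n ^ r / t = n ^ (k + 1 / q) kept sets.  Deleting one set from each kept dense
-- family leaves about n ^ (k + 1 / q) sets and no dense family; dense pairs are
-- exactly the pairs meeting in more than k vertices.  Expectations appear as
-- weighted sums over all subsets, so that the whole argument stays in ℕ.
module Submission where

open import Defs
open import Data.Bool.Base using (Bool; true; false; if_then_else_)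
open import Data.Fin.Base using (Fin; zero; suc; splitAt; _↑ˡ_; _↑ʳ_; join; fromℕ<)
open import Data.Fin.Properties using (splitAt-↑ˡ; splitAt-↑ʳ; join-splitAt)
import Data.Fin.Properties as Finₚ
open import Data.Fin.Subset using (Subset; inside; outside; _⊆_; _∈_; ∣_∣; ⊥; ⊤; ⋃; ⁅_⁆; _∪_; _∩_; Nonempty)
open import Data.Fin.Subset.Properties
  using (_⊆?_; _∈?_; drop-∷-⊆; out⊆; in⊆in; ⊆-trans; ⊆-antisym; ⊆-min; ⊥⊆; ⊆⊤; ∣⊥∣≡0; ∣⊤∣≡n; p⊆p∪q; q⊆p∪q;
         x∈p∪q⁺; x∈p∪q⁻; ∪-identityˡ; ∪-identityʳ; x∈⁅x⁆; x∈⁅y⁆⇒x≡y; ∣⁅x⁆∣≡1; p⊆q⇒∣p∣≤∣q∣)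
open import Data.List.Base using (List; []; _∷_; map; filter; allFin)
open import Data.List.Membership.Propositional using () renaming (_∈_ to _∈ₗ_)
open import Data.List.Membership.Propositional.Properties using (∈-map⁺; ∈-map⁻; ∈-filter⁺; ∈-filter⁻; ∈-allFin)
open import Data.List.Relation.Unary.Any using () renaming (here to hereₗ; there to thereₗ)
open import Data.Nat.Base
open import Data.Nat.Properties
open import Algebra.Properties.CommutativeSemigroup *-commutativeSemigroup using (x∙yz≈y∙xz; interchange)
open import Data.Nat.Tactic.RingSolver using (solve-∀)
open import Data.Product.Base using (∃-syntax; _×_; _,_; proj₁; proj₂)
import Data.Product.Base as Product
open import Data.Sum.Base using (_⊎_; inj₁; inj₂; [_,_]′)
open import Data.Vec.Base using ([]; _∷_; here; there; tabulate)
open import Data.Vec.Properties using (∷-injectiveˡ; ∷-injectiveʳ; tabulate-cong; lookup∘tabulate; lookup⇒[]=)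
open import Function.Base using (_∘_; id)
open import Level using (0ℓ)
open import Relation.Binary.PropositionalEquality
open import Relation.Nullary.Decidable using (Dec; does; yes; no; _×-dec_; dec-true; dec-false)
open import Relation.Nullary.Negation using (¬_; contradiction)
open import Relation.Unary using (Pred; Decidable)

-- Indicators and weighted sums over subsets

𝟙 : ∀ {a} {A : Set a} → Dec A → ℕ
𝟙 a? = if does a? then 1 else 0

module _ {a} {A : Set a} where

  𝟙-yes : (a? : Dec A) → A → 𝟙 a? ≡ 1
  𝟙-yes a? x rewrite dec-true a? x = refl

  𝟙-no : (a? : Dec A) → ¬ A → 𝟙 a? ≡ 0
  𝟙-no a? ¬x rewrite dec-false a? ¬x = refl

  𝟙-≤ : ∀ (a? : Dec A) {y} → (A → 1 ≤ y) → 𝟙 a? ≤ y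
  𝟙-≤ (yes x) 1≤y = 1≤y x
  𝟙-≤ (no _) _ = z≤n

  𝟙*-mono-≤ : ∀ (a? : Dec A) {x y} → (A → x ≤ y) → 𝟙 a? * x ≤ 𝟙 a? * y
  𝟙*-mono-≤ (yes p) x≤y = *-monoʳ-≤ 1 (x≤y p)
  𝟙*-mono-≤ (no _) _ = z≤n

𝟙-mono : ∀ {a b} {A : Set a} {B : Set b} (a? : Dec A) (b? : Dec B) → (A → B) → 𝟙 a? ≤ 𝟙 b?
𝟙-mono (no _) _ _ = z≤n
𝟙-mono (yes _) (yes _) _ = ≤-refl
𝟙-mono (yes x) (no ¬y) f = contradiction (f x) ¬y

-- ∑⟨ w ⟩ f is the sum of w ^ (N ∸ ∣ S ∣) * f S over all S ⊆ Fin N.  For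
-- w = t ∸ 1 it is t ^ N times the expectation of f on a random subset
-- containing each element independently with probability 1 / t.
∑⟨_⟩ : ℕ → ∀ {N} → (Subset N → ℕ) → ℕ
∑⟨ w ⟩ {zero} f = f []
∑⟨ w ⟩ {suc N} f = ∑⟨ w ⟩ (f ∘ (inside ∷_)) + w * ∑⟨ w ⟩ (f ∘ (outside ∷_))

∑ˢ : ∀ {N} → (Subset N → ℕ) → ℕ
∑ˢ = ∑⟨ 1 ⟩

∑ˢ-∷ : ∀ {N} (f : Subset (suc N) → ℕ) → ∑ˢ f ≡ ∑ˢ (f ∘ (inside ∷_)) + ∑ˢ (f ∘ (outside ∷_))
∑ˢ-∷ f = cong (∑ˢ (f ∘ (inside ∷_)) +_) (*-identityˡ _)

module _ (w : ℕ) where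

  ∑-cong : ∀ {N} {f g : Subset N → ℕ} → (∀ S → f S ≡ g S) → ∑⟨ w ⟩ f ≡ ∑⟨ w ⟩ g
  ∑-cong {zero} f≗g = f≗g []
  ∑-cong {suc N} f≗g = cong₂ (λ x y → x + w * y) (∑-cong (f≗g ∘ (inside ∷_))) (∑-cong (f≗g ∘ (outside ∷_)))

  ∑-mono-≤ : ∀ {N} {f g : Subset N → ℕ} → (∀ S → f S ≤ g S) → ∑⟨ w ⟩ f ≤ ∑⟨ w ⟩ g
  ∑-mono-≤ {zero} f≤g = f≤g []
  ∑-mono-≤ {suc N} f≤g = +-mono-≤ (∑-mono-≤ (f≤g ∘ (inside ∷_))) (*-monoʳ-≤ w (∑-mono-≤ (f≤g ∘ (outside ∷_))))

  ∑-distrib-+ : ∀ {N} (f g : Subset N → ℕ) → ∑⟨ w ⟩ (λ S → f S + g S) ≡ ∑⟨ w ⟩ f + ∑⟨ w ⟩ g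
  ∑-distrib-+ {zero} f g = refl
  ∑-distrib-+ {suc N} f g =
    trans (cong₂ (λ u v → u + w * v) (∑-distrib-+ (f ∘ (inside ∷_)) (g ∘ (inside ∷_)))
                                   (∑-distrib-+ (f ∘ (outside ∷_)) (g ∘ (outside ∷_))))
          (regroup w (∑⟨ w ⟩ (f ∘ (inside ∷_))) (∑⟨ w ⟩ (g ∘ (inside ∷_)))
                         (∑⟨ w ⟩ (f ∘ (outside ∷_))) (∑⟨ w ⟩ (g ∘ (outside ∷_))))
    where
    regroup : ∀ w x x′ y y′ → (x + x′) + w * (y + y′) ≡ (x + w * y) + (x′ + w * y′)
    regroup = solve-∀

  ∑-*ˡ : ∀ {N} a (f : Subset N → ℕ) → ∑⟨ w ⟩ (λ S → a * f S) ≡ a * ∑⟨ w ⟩ f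
  ∑-*ˡ {zero} a f = refl
  ∑-*ˡ {suc N} a f =
    trans (cong₂ (λ u v → u + w * v) (∑-*ˡ a (f ∘ (inside ∷_))) (∑-*ˡ a (f ∘ (outside ∷_)))) (factor w a _ _)
    where
    factor : ∀ w a x y → a * x + w * (a * y) ≡ a * (x + w * y)
    factor = solve-∀

  ∑-const : ∀ N a → ∑⟨ w ⟩ {N} (λ _ → a) ≡ suc w ^ N * a
  ∑-const zero a = sym (*-identityˡ a)
  ∑-const (suc N) a = trans (cong (λ x → x + w * x) (∑-const N a)) (sym (*-assoc (suc w) (suc w ^ N) a))

  ∑-zero : ∀ N → ∑⟨ w ⟩ {N} (λ _ → 0) ≡ 0
  ∑-zero N = trans (∑-const N 0) (*-zeroʳ (suc w ^ N))

  ∑-comm : ∀ u {M N} (h : Subset M → Subset N → ℕ) →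
           ∑⟨ u ⟩ (λ S → ∑⟨ w ⟩ (h S)) ≡ ∑⟨ w ⟩ (λ b → ∑⟨ u ⟩ (λ S → h S b))
  ∑-comm u {zero} h = refl
  ∑-comm u {suc M} h = begin
    ∑⟨ u ⟩ (λ S → ∑⟨ w ⟩ (h (inside ∷ S))) + u * ∑⟨ u ⟩ (λ S → ∑⟨ w ⟩ (h (outside ∷ S)))
      ≡⟨ cong₂ (λ x y → x + u * y) (∑-comm u (h ∘ (inside ∷_))) (∑-comm u (h ∘ (outside ∷_))) ⟩
    ∑⟨ w ⟩ (λ b → ∑⟨ u ⟩ (λ S → h (inside ∷ S) b)) + u * ∑⟨ w ⟩ (λ b → ∑⟨ u ⟩ (λ S → h (outside ∷ S) b))
      ≡⟨ cong (∑⟨ w ⟩ (λ b → ∑⟨ u ⟩ (λ S → h (inside ∷ S) b)) +_) (∑-*ˡ u (λ b → ∑⟨ u ⟩ (λ S → h (outside ∷ S) b))) ⟨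
    ∑⟨ w ⟩ (λ b → ∑⟨ u ⟩ (λ S → h (inside ∷ S) b)) + ∑⟨ w ⟩ (λ b → u * ∑⟨ u ⟩ (λ S → h (outside ∷ S) b))
      ≡⟨ ∑-distrib-+ (λ b → ∑⟨ u ⟩ (λ S → h (inside ∷ S) b)) (λ b → u * ∑⟨ u ⟩ (λ S → h (outside ∷ S) b)) ⟨
    ∑⟨ w ⟩ (λ b → ∑⟨ u ⟩ (λ S → h S b)) ∎
    where open ≡-Reasoning

  ∑-≤⇒∃-≤ : ∀ {N} (f g : Subset N → ℕ) → ∑⟨ w ⟩ f ≤ ∑⟨ w ⟩ g → ∃[ S ] f S ≤ g S
  ∑-≤⇒∃-≤ {zero} f g f≤g = [] , f≤g
  ∑-≤⇒∃-≤ {suc N} f g f≤g with ∑⟨ w ⟩ (f ∘ (inside ∷_)) ≤? ∑⟨ w ⟩ (g ∘ (inside ∷_))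
  ... | yes in≤ = Product.map (inside ∷_) id (∑-≤⇒∃-≤ (f ∘ (inside ∷_)) (g ∘ (inside ∷_)) in≤)
  ... | no in≰ = Product.map (outside ∷_) id (∑-≤⇒∃-≤ (f ∘ (outside ∷_)) (g ∘ (outside ∷_)) out≤)
    where
    out≤ : ∑⟨ w ⟩ (f ∘ (outside ∷_)) ≤ ∑⟨ w ⟩ (g ∘ (outside ∷_))
    out≤ = <⇒≤ (*-cancelˡ-< w _ _ (+-cancelˡ-< (∑⟨ w ⟩ (g ∘ (inside ∷_))) _ _
                                                (<-≤-trans (+-monoˡ-< _ (≰⇒> in≰)) f≤g)))

∑-term : ∀ w {N} (f : Subset N → ℕ) S → f S ≤ ∑⟨ suc w ⟩ f
∑-term w f [] = ≤-refl
∑-term w f (inside ∷ S) = ≤-trans (∑-term w (f ∘ (inside ∷_)) S) (m≤m+n _ _)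
∑-term w f (outside ∷ S) =
  ≤-trans (∑-term w (f ∘ (outside ∷_)) S) (≤-trans (m≤m+n _ _) (m≤n+m _ (∑⟨ suc w ⟩ (f ∘ (inside ∷_)))))

module _ (w : ℕ) where

  ∑-⊆? : ∀ {N} (b : Subset N) → suc w ^ ∣ b ∣ * ∑⟨ w ⟩ (λ S → 𝟙 (b ⊆? S)) ≡ suc w ^ N
  ∑-⊆? [] = refl
  ∑-⊆? {suc N} (outside ∷ b) = begin
    suc w ^ ∣ b ∣ * (x + w * x) ≡⟨ x∙yz≈y∙xz (suc w ^ ∣ b ∣) (suc w) x ⟩
    suc w * (suc w ^ ∣ b ∣ * x) ≡⟨ cong (suc w *_) (∑-⊆? b) ⟩
    suc w * suc w ^ N ∎
    where
    open ≡-Reasoning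
    x = ∑⟨ w ⟩ {N} (λ S → 𝟙 (b ⊆? S))
  ∑-⊆? {suc N} (inside ∷ b) = begin
    suc w * suc w ^ ∣ b ∣ * (x + w * ∑⟨ w ⟩ {N} (λ _ → 0))
      ≡⟨ cong (λ z → suc w * suc w ^ ∣ b ∣ * (x + w * z)) (∑-zero w N) ⟩
    suc w * suc w ^ ∣ b ∣ * (x + w * 0) ≡⟨ drop-zero w (suc w ^ ∣ b ∣) x ⟩
    suc w * (suc w ^ ∣ b ∣ * x) ≡⟨ cong (suc w *_) (∑-⊆? b) ⟩
    suc w * suc w ^ N ∎
    where
    open ≡-Reasoning
    x = ∑⟨ w ⟩ {N} (λ S → 𝟙 (b ⊆? S))
    drop-zero : ∀ w y x → suc w * y * (x + w * 0) ≡ suc w * (y * x)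
    drop-zero = solve-∀

  ∑-∣∣ : ∀ N → suc w * ∑⟨ w ⟩ {N} ∣_∣ ≡ N * suc w ^ N
  ∑-∣∣ zero = *-zeroʳ (suc w)
  ∑-∣∣ (suc N) = begin
    suc w * (∑⟨ w ⟩ {N} (λ S → 1 + ∣ S ∣) + w * y)
      ≡⟨ cong (λ z → suc w * (z + w * y)) (trans (∑-distrib-+ w {N} (λ _ → 1) ∣_∣) (cong (_+ y) (∑-const w N 1))) ⟩
    suc w * (suc w ^ N * 1 + y + w * y) ≡⟨ regroup w (suc w ^ N) y ⟩
    suc w * suc w ^ N + suc w * (suc w * y) ≡⟨ cong (λ z → suc w * suc w ^ N + suc w * z) (∑-∣∣ N) ⟩
    suc w * suc w ^ N + suc w * (N * suc w ^ N) ≡⟨ cong (suc w * suc w ^ N +_) (x∙yz≈y∙xz (suc w) N (suc w ^ N)) ⟩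
    suc N * (suc w * suc w ^ N) ∎
    where
    open ≡-Reasoning
    y = ∑⟨ w ⟩ {N} ∣_∣
    regroup : ∀ w p y → suc w * (p * 1 + y + w * y) ≡ suc w * p + suc w * (suc w * y)
    regroup = solve-∀

  ∑-×-dec-⊆? : ∀ {N} {A : Set} (a? : Dec A) (b : Subset N) k → (A → ∣ b ∣ ≤ k) →
               suc w ^ k * ∑⟨ w ⟩ (λ S → 𝟙 (a? ×-dec b ⊆? S)) ≡ suc w ^ N * (𝟙 a? * suc w ^ (k ∸ ∣ b ∣))
  ∑-×-dec-⊆? {N} (no _) b k _ = begin
    suc w ^ k * ∑⟨ w ⟩ {N} (λ _ → 0) ≡⟨ cong (suc w ^ k *_) (∑-zero w N) ⟩
    suc w ^ k * 0 ≡⟨ *-zeroʳ (suc w ^ k) ⟩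
    0 ≡⟨ *-zeroʳ (suc w ^ N) ⟨
    suc w ^ N * 0 ∎
    where open ≡-Reasoning
  ∑-×-dec-⊆? {N} (yes a) b k A⇒∣b∣≤k = begin
    suc w ^ k * x ≡⟨ cong (λ e → suc w ^ e * x) (m+[n∸m]≡n (A⇒∣b∣≤k a)) ⟨
    suc w ^ (∣ b ∣ + (k ∸ ∣ b ∣)) * x ≡⟨ cong (_* x) (^-distribˡ-+-* (suc w) ∣ b ∣ (k ∸ ∣ b ∣)) ⟩
    suc w ^ ∣ b ∣ * suc w ^ (k ∸ ∣ b ∣) * x
      ≡⟨ trans (*-assoc (suc w ^ ∣ b ∣) _ x) (x∙yz≈y∙xz (suc w ^ ∣ b ∣) (suc w ^ (k ∸ ∣ b ∣)) x) ⟩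
    suc w ^ (k ∸ ∣ b ∣) * (suc w ^ ∣ b ∣ * x) ≡⟨ cong (suc w ^ (k ∸ ∣ b ∣) *_) (∑-⊆? b) ⟩
    suc w ^ (k ∸ ∣ b ∣) * suc w ^ N ≡⟨ *-comm _ (suc w ^ N) ⟩
    suc w ^ N * suc w ^ (k ∸ ∣ b ∣) ≡⟨ cong (suc w ^ N *_) (*-identityˡ _) ⟨
    suc w ^ N * (1 * suc w ^ (k ∸ ∣ b ∣)) ∎
    where
    open ≡-Reasoning
    x = ∑⟨ w ⟩ {N} (λ S → 𝟙 (b ⊆? S))

∑< : ℕ → (ℕ → ℕ) → ℕ
∑< zero f = 0
∑< (suc L) f = f L + ∑< L f

∑<-term : ∀ L f {i} → i < L → f i ≤ ∑< L f
∑<-term (suc L) f {i} i<1+L with i ≟ L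
... | yes refl = m≤m+n _ _
... | no i≢L = ≤-trans (∑<-term L f (≤∧≢⇒< (≤-pred i<1+L) i≢L)) (m≤n+m _ (f L))

∑<-mono-≤ : ∀ L {f g} → (∀ i → i < L → f i ≤ g i) → ∑< L f ≤ ∑< L g
∑<-mono-≤ zero _ = z≤n
∑<-mono-≤ (suc L) f≤g = +-mono-≤ (f≤g L ≤-refl) (∑<-mono-≤ L (λ i i<L → f≤g i (m<n⇒m<1+n i<L)))

∑<-*ˡ : ∀ L a f → ∑< L (λ i → a * f i) ≡ a * ∑< L f
∑<-*ˡ zero a f = sym (*-zeroʳ a)
∑<-*ˡ (suc L) a f = trans (cong (a * f L +_) (∑<-*ˡ L a f)) (sym (*-distribˡ-+ a (f L) _))

∑<-const : ∀ L a → ∑< L (λ _ → a) ≡ L * a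
∑<-const zero a = refl
∑<-const (suc L) a = cong (a +_) (∑<-const L a)

∑<-≤ : ∀ L f c → (∀ i → i < L → L * f i ≤ c) → ∑< L f ≤ c
∑<-≤ zero f c _ = z≤n
∑<-≤ L@(suc _) f c Lf≤c = *-cancelˡ-≤ L (begin
  L * ∑< L f ≡⟨ ∑<-*ˡ L L f ⟨
  ∑< L (λ i → L * f i) ≤⟨ ∑<-mono-≤ L Lf≤c ⟩
  ∑< L (λ _ → c) ≡⟨ ∑<-const L c ⟩
  L * c ∎)
  where open ≤-Reasoning

∑-∑< : ∀ w {N} L (h : Subset N → ℕ → ℕ) → ∑⟨ w ⟩ (λ S → ∑< L (h S)) ≡ ∑< L (λ i → ∑⟨ w ⟩ (λ S → h S i))
∑-∑< w {N} zero h = ∑-zero w N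
∑-∑< w (suc L) h =
  trans (∑-distrib-+ w (λ S → h S L) (λ S → ∑< L (h S))) (cong (∑⟨ w ⟩ (λ S → h S L) +_) (∑-∑< w L h))

∑-by-size : ∀ {N} {P : Pred (Subset N) 0ℓ} (P? : Decidable P) L (g : ℕ → ℕ) →
            (∀ b → P b → 1 ≤ ∣ b ∣ × ∣ b ∣ ≤ L) →
            ∑ˢ (λ b → 𝟙 (P? b) * g ∣ b ∣) ≤ ∑< L (λ i → g (suc i) * ∑ˢ (λ b → 𝟙 (P? b ×-dec ∣ b ∣ ≟ suc i)))
∑-by-size {N} P? L g P⇒size = begin
  ∑ˢ (λ b → 𝟙 (P? b) * g ∣ b ∣) ≤⟨ ∑-mono-≤ 1 split ⟩
  ∑ˢ (λ b → ∑< L (λ i → g (suc i) * 𝟙 (P? b ×-dec ∣ b ∣ ≟ suc i)))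
    ≡⟨ ∑-∑< 1 L (λ b i → g (suc i) * 𝟙 (P? b ×-dec ∣ b ∣ ≟ suc i)) ⟩
  ∑< L (λ i → ∑ˢ (λ b → g (suc i) * 𝟙 (P? b ×-dec ∣ b ∣ ≟ suc i)))
    ≤⟨ ∑<-mono-≤ L (λ i _ → ≤-reflexive (∑-*ˡ 1 (g (suc i)) (λ b → 𝟙 (P? b ×-dec ∣ b ∣ ≟ suc i)))) ⟩
  ∑< L (λ i → g (suc i) * ∑ˢ (λ b → 𝟙 (P? b ×-dec ∣ b ∣ ≟ suc i))) ∎
  where
  open ≤-Reasoning
  pick : ∀ s → 1 ≤ s → s ≤ L → g s ≤ ∑< L (λ i → g (suc i) * 𝟙 (s ≟ suc i))
  pick (suc i) _ s≤L = ≤-trans (≤-reflexive g≡) (∑<-term L (λ i′ → g (suc i′) * 𝟙 (suc i ≟ suc i′)) s≤L)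
    where
    g≡ : g (suc i) ≡ g (suc i) * 𝟙 (suc i ≟ suc i)
    g≡ = trans (sym (*-identityʳ _)) (cong (g (suc i) *_) (sym (𝟙-yes (suc i ≟ suc i) refl)))
  split : ∀ b → 𝟙 (P? b) * g ∣ b ∣ ≤ ∑< L (λ i → g (suc i) * 𝟙 (P? b ×-dec ∣ b ∣ ≟ suc i))
  split b with P? b
  ... | no _ = z≤n
  ... | yes Pb = ≤-trans (≤-reflexive (*-identityˡ _)) (pick ∣ b ∣ (proj₁ (P⇒size b Pb)) (proj₂ (P⇒size b Pb)))

-- The deletion method

-- Recursively thin the tail of S; then drop element 0 exactly when a bad set
-- through 0 survives, and charge the loss to that bad set.
deletion : ∀ {N} {P : Pred (Subset N) 0ℓ} (P? : Decidable P) → ¬ P ⊥ → ∀ S →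
           ∃[ S′ ] (S′ ⊆ S × ∣ S ∣ ≤ ∣ S′ ∣ + ∑ˢ (λ b → 𝟙 (P? b ×-dec b ⊆? S)) × (∀ b → P b → ¬ b ⊆ S′))
deletion {zero} {P} P? ¬P⊥ [] = [] , (λ x∈[] → x∈[]) , z≤n , free
  where
  free : ∀ b → P b → ¬ b ⊆ []
  free [] Pb _ = ¬P⊥ Pb
deletion {suc N} {P} P? ¬P⊥ (x ∷ S) with deletion (P? ∘ (outside ∷_)) ¬P⊥ S
... | S₀ , S₀⊆S , S≤S₀+C₀ , free₀ = keep-or-drop x
  where
  C₀ C₁ : Subset N → ℕ
  C₀ T = ∑ˢ (λ b → 𝟙 (P? (outside ∷ b) ×-dec b ⊆? T))
  C₁ T = ∑ˢ (λ b → 𝟙 (P? (inside ∷ b) ×-dec b ⊆? T))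

  C₀≤ : ∀ c → C₀ S ≤ c + 1 * C₀ S
  C₀≤ c = ≤-trans (≤-reflexive (sym (*-identityˡ (C₀ S)))) (m≤n+m _ c)

  free-out : ∀ b → P b → ¬ b ⊆ outside ∷ S₀
  free-out (inside ∷ b) _ b⊆ with b⊆ here
  ... | ()
  free-out (outside ∷ b) Pb b⊆ = free₀ b Pb (drop-∷-⊆ b⊆)

  C₁-mono : C₁ S₀ ≤ C₁ S
  C₁-mono = ∑-mono-≤ 1 (λ b → 𝟙-mono (P? (inside ∷ b) ×-dec b ⊆? S₀) (P? (inside ∷ b) ×-dec b ⊆? S)
                                      (λ (Pb , b⊆S₀) → Pb , ⊆-trans b⊆S₀ S₀⊆S))

  keep-or-drop : ∀ x → ∃[ S′ ] (S′ ⊆ x ∷ S × ∣ x ∷ S ∣ ≤ ∣ S′ ∣ + ∑ˢ (λ b → 𝟙 (P? b ×-dec b ⊆? x ∷ S))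
                               × (∀ b → P b → ¬ b ⊆ S′))
  keep-or-drop outside = outside ∷ S₀ , out⊆ S₀⊆S , ≤-trans S≤S₀+C₀ (+-monoʳ-≤ ∣ S₀ ∣ (C₀≤ C₁′)) , free-out
    where
    C₁′ = ∑ˢ (λ b → 𝟙 (P? (inside ∷ b) ×-dec inside ∷ b ⊆? outside ∷ S))
  keep-or-drop inside with C₁ S₀ in C₁S₀≡
  ... | zero = inside ∷ S₀ , in⊆in S₀⊆S , s≤s (≤-trans S≤S₀+C₀ (+-monoʳ-≤ ∣ S₀ ∣ (C₀≤ (C₁ S)))) , free-in
    where
    free-in : ∀ b → P b → ¬ b ⊆ inside ∷ S₀
    free-in (inside ∷ b) Pb b⊆ = contradiction (≤-trans 1≤term (≤-trans term≤C₁S₀ (≤-reflexive C₁S₀≡))) λ ()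
      where
      1≤term : 1 ≤ 𝟙 (P? (inside ∷ b) ×-dec b ⊆? S₀)
      1≤term = ≤-reflexive (sym (𝟙-yes (P? (inside ∷ b) ×-dec b ⊆? S₀) (Pb , drop-∷-⊆ b⊆)))
      term≤C₁S₀ : 𝟙 (P? (inside ∷ b) ×-dec b ⊆? S₀) ≤ C₁ S₀
      term≤C₁S₀ = ∑-term 0 (λ b → 𝟙 (P? (inside ∷ b) ×-dec b ⊆? S₀)) b
    free-in (outside ∷ b) Pb b⊆ = free₀ b Pb (drop-∷-⊆ b⊆)
  ... | suc _ = outside ∷ S₀ , out⊆ S₀⊆S , count , free-out
    where
    open ≤-Reasoning
    count : suc ∣ S ∣ ≤ ∣ S₀ ∣ + (C₁ S + 1 * C₀ S)
    count = begin
      suc ∣ S ∣ ≤⟨ s≤s S≤S₀+C₀ ⟩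
      suc (∣ S₀ ∣ + C₀ S) ≡⟨ +-suc ∣ S₀ ∣ (C₀ S) ⟨
      ∣ S₀ ∣ + (1 + C₀ S) ≤⟨ +-monoʳ-≤ ∣ S₀ ∣ (+-mono-≤ 1≤C₁S (≤-reflexive (sym (*-identityˡ (C₀ S))))) ⟩
      ∣ S₀ ∣ + (C₁ S + 1 * C₀ S) ∎
      where
      1≤C₁S : 1 ≤ C₁ S
      1≤C₁S = ≤-trans (s≤s z≤n) (≤-trans (≤-reflexive (sym C₁S₀≡)) C₁-mono)

module _ (w : ℕ) {N} {P : Pred (Subset N) 0ℓ} (P? : Decidable P) (J : ℕ) (P⇒≤ : ∀ b → P b → ∣ b ∣ ≤ suc J) where

  private
    t = suc w
    T = t ^ suc J
    weight : Subset N → ℕ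
    weight b = 𝟙 (P? b) * t ^ (suc J ∸ ∣ b ∣)
    bad-inside : Subset N → ℕ
    bad-inside S = ∑ˢ (λ b → 𝟙 (P? b ×-dec b ⊆? S))

  ∑-bad-inside : T * ∑⟨ w ⟩ bad-inside ≡ t ^ N * ∑ˢ weight
  ∑-bad-inside = begin
    T * ∑⟨ w ⟩ bad-inside ≡⟨ cong (T *_) (∑-comm 1 w (λ S b → 𝟙 (P? b ×-dec b ⊆? S))) ⟩
    T * ∑ˢ (λ b → ∑⟨ w ⟩ (λ S → 𝟙 (P? b ×-dec b ⊆? S))) ≡⟨ ∑-*ˡ 1 T (λ b → ∑⟨ w ⟩ (λ S → 𝟙 (P? b ×-dec b ⊆? S))) ⟨
    ∑ˢ (λ b → T * ∑⟨ w ⟩ (λ S → 𝟙 (P? b ×-dec b ⊆? S))) ≡⟨ ∑-cong 1 (λ b → ∑-×-dec-⊆? w (P? b) b (suc J) (P⇒≤ b)) ⟩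
    ∑ˢ (λ b → t ^ N * weight b) ≡⟨ ∑-*ˡ 1 (t ^ N) weight ⟩
    t ^ N * ∑ˢ weight ∎
    where open ≡-Reasoning

  ∑-bad-inside+X≤∑-size : ∀ X → ∑ˢ weight + T * X ≤ t ^ J * N → ∑⟨ w ⟩ (λ S → bad-inside S + X) ≤ ∑⟨ w ⟩ {N} ∣_∣
  ∑-bad-inside+X≤∑-size X hyp = *-cancelˡ-≤ T {{m^n≢0 t (suc J)}} (begin
    T * ∑⟨ w ⟩ (λ S → bad-inside S + X)
      ≡⟨ cong (T *_) (trans (∑-distrib-+ w bad-inside (λ _ → X)) (cong (∑⟨ w ⟩ bad-inside +_) (∑-const w N X))) ⟩
    T * (∑⟨ w ⟩ bad-inside + t ^ N * X) ≡⟨ *-distribˡ-+ T _ _ ⟩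
    T * ∑⟨ w ⟩ bad-inside + T * (t ^ N * X) ≡⟨ cong₂ _+_ ∑-bad-inside (x∙yz≈y∙xz T (t ^ N) X) ⟩
    t ^ N * ∑ˢ weight + t ^ N * (T * X) ≡⟨ *-distribˡ-+ (t ^ N) _ _ ⟨
    t ^ N * (∑ˢ weight + T * X) ≤⟨ *-monoʳ-≤ (t ^ N) hyp ⟩
    t ^ N * (t ^ J * N) ≡⟨ x∙yz≈y∙xz (t ^ N) (t ^ J) N ⟩
    t ^ J * (t ^ N * N) ≡⟨ cong (t ^ J *_) (trans (*-comm (t ^ N) N) (sym (∑-∣∣ w N))) ⟩
    t ^ J * (t * ∑⟨ w ⟩ {N} ∣_∣) ≡⟨ x∙yz≈y∙xz (t ^ J) t (∑⟨ w ⟩ {N} ∣_∣) ⟩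
    t * (t ^ J * ∑⟨ w ⟩ {N} ∣_∣) ≡⟨ *-assoc t (t ^ J) (∑⟨ w ⟩ {N} ∣_∣) ⟨
    T * ∑⟨ w ⟩ {N} ∣_∣ ∎)
    where open ≤-Reasoning

  -- Divided by t ^ suc J, the hypothesis says that the expected number of bad
  -- sets inside S plus X is at most the expected size N / t of S.
  alteration : ¬ P ⊥ → ∀ X → ∑ˢ weight + T * X ≤ t ^ J * N → ∃[ S ] (X ≤ ∣ S ∣ × (∀ b → P b → ¬ b ⊆ S))
  alteration ¬P⊥ X hyp with ∑-≤⇒∃-≤ w (λ S → bad-inside S + X) ∣_∣ (∑-bad-inside+X≤∑-size X hyp)
  ... | S , bad+X≤∣S∣ with deletion P? ¬P⊥ S
  ... | S′ , _ , ∣S∣≤∣S′∣+bad , free = S′ , X≤∣S′∣ , free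
    where
    X≤∣S′∣ : X ≤ ∣ S′ ∣
    X≤∣S′∣ = +-cancelˡ-≤ (bad-inside S) X ∣ S′ ∣
               (≤-trans bad+X≤∣S∣ (≤-trans ∣S∣≤∣S′∣+bad (≤-reflexive (+-comm ∣ S′ ∣ (bad-inside S)))))

-- Subsets of finite sets

⊆⋃ : ∀ {n} {A} {As : List (Subset n)} → A ∈ₗ As → A ⊆ ⋃ As
⊆⋃ (hereₗ refl) = p⊆p∪q _
⊆⋃ {As = A ∷ As} (thereₗ A∈As) = ⊆-trans (⊆⋃ A∈As) (q⊆p∪q A (⋃ As))

⋃-least : ∀ {n} {W : Subset n} (As : List (Subset n)) → (∀ {A} → A ∈ₗ As → A ⊆ W) → ⋃ As ⊆ W
⋃-least [] _ = ⊥⊆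
⋃-least (A ∷ As) As⊆W x∈ = [ As⊆W (hereₗ refl) , ⋃-least As (As⊆W ∘ thereₗ) ]′ (x∈p∪q⁻ A (⋃ As) x∈)

⋃ᶠ : ∀ {M n} → (Fin M → Subset n) → Subset M → Subset n
⋃ᶠ {M} f S = ⋃ (map f (filter (_∈? S) (allFin M)))

⊆⋃ᶠ : ∀ {M n} (f : Fin M → Subset n) {S i} → i ∈ S → f i ⊆ ⋃ᶠ f S
⊆⋃ᶠ f {S} {i} i∈S = ⊆⋃ (∈-map⁺ f (∈-filter⁺ (_∈? S) (∈-allFin i) i∈S))

⋃ᶠ-least : ∀ {M n} (f : Fin M → Subset n) {S W} → (∀ {i} → i ∈ S → f i ⊆ W) → ⋃ᶠ f S ⊆ W
⋃ᶠ-least {M} f {S} {W} fS⊆W = ⋃-least _ λ A∈ → on-preimage (∈-map⁻ f A∈)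
  where
  on-preimage : ∀ {A} → ∃[ i ] (i ∈ₗ filter (_∈? S) (allFin M) × A ≡ f i) → A ⊆ W
  on-preimage (i , i∈ , refl) = fS⊆W (proj₂ (∈-filter⁻ (_∈? S) {xs = allFin M} i∈))

∣p∪q∣+∣p∩q∣ : ∀ {n} (p q : Subset n) → ∣ p ∪ q ∣ + ∣ p ∩ q ∣ ≡ ∣ p ∣ + ∣ q ∣
∣p∪q∣+∣p∩q∣ [] [] = refl
∣p∪q∣+∣p∩q∣ (inside ∷ p) (inside ∷ q) =
  cong suc (trans (+-suc ∣ p ∪ q ∣ ∣ p ∩ q ∣) (trans (cong suc (∣p∪q∣+∣p∩q∣ p q)) (sym (+-suc ∣ p ∣ ∣ q ∣))))
∣p∪q∣+∣p∩q∣ (inside ∷ p) (outside ∷ q) = cong suc (∣p∪q∣+∣p∩q∣ p q)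
∣p∪q∣+∣p∩q∣ (outside ∷ p) (inside ∷ q) = trans (cong suc (∣p∪q∣+∣p∩q∣ p q)) (sym (+-suc ∣ p ∣ ∣ q ∣))
∣p∪q∣+∣p∩q∣ (outside ∷ p) (outside ∷ q) = ∣p∪q∣+∣p∩q∣ p q

∣⁅x⁆∪⁅y⁆∣ : ∀ {n} {x y : Fin n} → x ≢ y → ∣ ⁅ x ⁆ ∪ ⁅ y ⁆ ∣ ≡ 2
∣⁅x⁆∪⁅y⁆∣ {x = zero} {zero} x≢y = contradiction refl x≢y
∣⁅x⁆∪⁅y⁆∣ {x = zero} {suc y} _ = cong suc (trans (cong ∣_∣ (∪-identityˡ ⁅ y ⁆)) (∣⁅x⁆∣≡1 y))
∣⁅x⁆∪⁅y⁆∣ {x = suc x} {zero} _ = cong suc (trans (cong ∣_∣ (∪-identityʳ ⁅ x ⁆)) (∣⁅x⁆∣≡1 x))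
∣⁅x⁆∪⁅y⁆∣ {x = suc x} {suc y} x≢y = ∣⁅x⁆∪⁅y⁆∣ (x≢y ∘ cong suc)

⋃ᶠ-⁅x⁆∪⁅y⁆ : ∀ {M n} (f : Fin M → Subset n) x y → ⋃ᶠ f (⁅ x ⁆ ∪ ⁅ y ⁆) ≡ f x ∪ f y
⋃ᶠ-⁅x⁆∪⁅y⁆ f x y = ⊆-antisym
  (⋃ᶠ-least f λ {i} i∈ → [ (λ i∈⁅x⁆ → subst (λ j → f j ⊆ f x ∪ f y) (sym (x∈⁅y⁆⇒x≡y x i∈⁅x⁆)) (p⊆p∪q (f y)))
                         , (λ i∈⁅y⁆ → subst (λ j → f j ⊆ f x ∪ f y) (sym (x∈⁅y⁆⇒x≡y y i∈⁅y⁆)) (q⊆p∪q (f x) (f y))) ]′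
                         (x∈p∪q⁻ ⁅ x ⁆ ⁅ y ⁆ i∈))
  (λ z∈ → [ ⊆⋃ᶠ f (x∈p∪q⁺ (inj₁ (x∈⁅x⁆ x))) , ⊆⋃ᶠ f (x∈p∪q⁺ (inj₂ (x∈⁅x⁆ y))) ]′ (x∈p∪q⁻ (f x) (f y) z∈))

Nonempty⁺ : ∀ {n} (p : Subset n) → 1 ≤ ∣ p ∣ → Nonempty p
Nonempty⁺ (inside ∷ p) _ = zero , here
Nonempty⁺ (outside ∷ p) 1≤∣p∣ = Product.map suc there (Nonempty⁺ p 1≤∣p∣)

nth : ∀ {N} (p : Subset N) → Fin ∣ p ∣ → Fin N
nth (inside ∷ p) zero = zero
nth (inside ∷ p) (suc i) = suc (nth p i)
nth (outside ∷ p) i = suc (nth p i)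

nth-injective : ∀ {N} (p : Subset N) {i j} → nth p i ≡ nth p j → i ≡ j
nth-injective (inside ∷ p) {zero} {zero} _ = refl
nth-injective (inside ∷ p) {suc i} {suc j} e = cong suc (nth-injective p (Finₚ.suc-injective e))
nth-injective (outside ∷ p) e = nth-injective p (Finₚ.suc-injective e)

embed : ∀ {N} (p : Subset N) → Subset ∣ p ∣ → Subset N
embed [] [] = []
embed (inside ∷ p) (x ∷ S) = x ∷ embed p S
embed (outside ∷ p) S = outside ∷ embed p S

∣embed∣ : ∀ {N} (p : Subset N) S → ∣ embed p S ∣ ≡ ∣ S ∣
∣embed∣ [] [] = refl
∣embed∣ (inside ∷ p) (inside ∷ S) = cong suc (∣embed∣ p S)
∣embed∣ (inside ∷ p) (outside ∷ S) = ∣embed∣ p S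
∣embed∣ (outside ∷ p) S = ∣embed∣ p S

embed-⊆ : ∀ {N} (p : Subset N) S → embed p S ⊆ p
embed-⊆ (inside ∷ p) (x ∷ S) here = here
embed-⊆ (inside ∷ p) (x ∷ S) (there j∈) = there (embed-⊆ p S j∈)
embed-⊆ (outside ∷ p) S (there j∈) = there (embed-⊆ p S j∈)

∈embed⁺ : ∀ {N} (p : Subset N) S {i} → i ∈ S → nth p i ∈ embed p S
∈embed⁺ (inside ∷ p) (x ∷ S) here = here
∈embed⁺ (inside ∷ p) (x ∷ S) (there i∈S) = there (∈embed⁺ p S i∈S)
∈embed⁺ (outside ∷ p) S i∈S = there (∈embed⁺ p S i∈S)

∈embed⁻ : ∀ {N} (p : Subset N) S {j} → j ∈ embed p S → ∃[ i ] (i ∈ S × nth p i ≡ j)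
∈embed⁻ (inside ∷ p) (x ∷ S) here = zero , here , refl
∈embed⁻ (inside ∷ p) (x ∷ S) (there j∈) with ∈embed⁻ p S j∈
... | i , i∈S , refl = suc i , there i∈S , refl
∈embed⁻ (outside ∷ p) S (there j∈) with ∈embed⁻ p S j∈
... | i , i∈S , refl = i , i∈S , refl

⋃ᶠ-embed : ∀ {N n} (f : Fin N → Subset n) (p : Subset N) S → ⋃ᶠ f (embed p S) ≡ ⋃ᶠ (f ∘ nth p) S
⋃ᶠ-embed f p S = ⊆-antisym
  (⋃ᶠ-least f λ j∈ → on-preimage (∈embed⁻ p S j∈))
  (⋃ᶠ-least (f ∘ nth p) λ i∈S → ⊆⋃ᶠ f (∈embed⁺ p S i∈S))
  where
  on-preimage : ∀ {j} → ∃[ i ] (i ∈ S × nth p i ≡ j) → f j ⊆ ⋃ᶠ (f ∘ nth p) S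
  on-preimage (i , i∈S , refl) = ⊆⋃ᶠ (f ∘ nth p) i∈S

within : ∀ {M n} → (Fin M → Subset n) → Subset n → Subset M
within f W = tabulate (λ i → does (f i ⊆? W))

∈within⁺ : ∀ {M n} (f : Fin M → Subset n) {W i} → f i ⊆ W → i ∈ within f W
∈within⁺ f {W} {i} fi⊆W = lookup⇒[]= i _ (trans (lookup∘tabulate _ i) (dec-true (f i ⊆? W) fi⊆W))

∑-small-subsets : ∀ {N} (C : Subset N) j → ∑ˢ (λ b → 𝟙 (b ⊆? C ×-dec ∣ b ∣ ≤? j)) ≤ suc ∣ C ∣ ^ j
∑-small-subsets [] j = ≤-reflexive (sym (^-zeroˡ j))
∑-small-subsets {suc N} (outside ∷ C) j = begin
  ∑ˢ {N} (λ _ → 0) + 1 * ∑ˢ (λ b → 𝟙 (b ⊆? C ×-dec ∣ b ∣ ≤? j))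
    ≡⟨ cong₂ _+_ (∑-zero 1 N) (*-identityˡ _) ⟩
  ∑ˢ (λ b → 𝟙 (b ⊆? C ×-dec ∣ b ∣ ≤? j)) ≤⟨ ∑-small-subsets C j ⟩
  suc ∣ C ∣ ^ j ∎
  where open ≤-Reasoning
∑-small-subsets {suc N} (inside ∷ C) j =
  ≤-trans (≤-reflexive (∑ˢ-∷ (λ b → 𝟙 (b ⊆? inside ∷ C ×-dec ∣ b ∣ ≤? j)))) (split j)
  where
  open ≤-Reasoning
  c = suc ∣ C ∣
  split : ∀ j → ∑ˢ (λ b → 𝟙 (b ⊆? C ×-dec suc ∣ b ∣ ≤? j)) + ∑ˢ (λ b → 𝟙 (b ⊆? C ×-dec ∣ b ∣ ≤? j)) ≤ suc c ^ j
  split zero = +-mono-≤ none (∑-small-subsets C zero)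
    where
    none : ∑ˢ (λ b → 𝟙 (b ⊆? C ×-dec suc ∣ b ∣ ≤? 0)) ≤ 0
    none = ≤-trans (∑-mono-≤ 1 (λ b → ≤-reflexive (𝟙-no (b ⊆? C ×-dec suc ∣ b ∣ ≤? 0) (λ ()))))
                   (≤-reflexive (∑-zero 1 N))
  split (suc j) = begin
    ∑ˢ (λ b → 𝟙 (b ⊆? C ×-dec suc ∣ b ∣ ≤? suc j)) + ∑ˢ (λ b → 𝟙 (b ⊆? C ×-dec ∣ b ∣ ≤? suc j))
      ≤⟨ +-mono-≤ (≤-trans (∑-mono-≤ 1 (λ b → 𝟙-mono (b ⊆? C ×-dec suc ∣ b ∣ ≤? suc j) (b ⊆? C ×-dec ∣ b ∣ ≤? j)
                                                      (Product.map₂ s≤s⁻¹)))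
                            (∑-small-subsets C j))
                  (∑-small-subsets C (suc j)) ⟩
    suc c * c ^ j ≤⟨ *-monoʳ-≤ (suc c) (^-monoˡ-≤ j (n≤1+n c)) ⟩
    suc c * suc c ^ j ∎

∑-small-sets : ∀ n j → ∑ˢ {n} (λ W → 𝟙 (∣ W ∣ ≤? j)) ≤ suc n ^ j
∑-small-sets n j = begin
  ∑ˢ {n} (λ W → 𝟙 (∣ W ∣ ≤? j)) ≤⟨ ∑-mono-≤ 1 {n} (λ W → 𝟙-mono (∣ W ∣ ≤? j) (W ⊆? ⊤ ×-dec ∣ W ∣ ≤? j) (⊆⊤ ,_)) ⟩
  ∑ˢ {n} (λ W → 𝟙 (W ⊆? ⊤ ×-dec ∣ W ∣ ≤? j)) ≤⟨ ∑-small-subsets (⊤ {n}) j ⟩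
  suc ∣ ⊤ {n} ∣ ^ j ≡⟨ cong (λ x → suc x ^ j) (∣⊤∣≡n n) ⟩
  suc n ^ j ∎
  where open ≤-Reasoning

-- A family b of indices with a small union U is counted through W = U: there
-- are few candidates W, and b is a small subset of the indices inside W.
∑-small-union : ∀ {M n} (f : Fin M → Subset n) V K j → (∀ W → ∣ W ∣ ≤ V → ∣ within f W ∣ ≤ K) →
                ∑ˢ (λ b → 𝟙 (∣ ⋃ᶠ f b ∣ ≤? V ×-dec ∣ b ∣ ≤? j)) ≤ suc n ^ V * suc K ^ j
∑-small-union {M} {n} f V K j within≤K = begin
  ∑ˢ (λ b → 𝟙 (∣ ⋃ᶠ f b ∣ ≤? V ×-dec ∣ b ∣ ≤? j)) ≤⟨ ∑-mono-≤ 1 via-union ⟩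
  ∑ˢ (λ b → ∑ˢ {n} (λ W → h W b)) ≡⟨ ∑-comm 1 1 (λ b W → h W b) ⟩
  ∑ˢ {n} (λ W → ∑ˢ (h W))
    ≡⟨ ∑-cong 1 {n} (λ W → ∑-*ˡ 1 (𝟙 (∣ W ∣ ≤? V)) (λ b → 𝟙 (b ⊆? within f W ×-dec ∣ b ∣ ≤? j))) ⟩
  ∑ˢ {n} (λ W → 𝟙 (∣ W ∣ ≤? V) * ∑ˢ (λ b → 𝟙 (b ⊆? within f W ×-dec ∣ b ∣ ≤? j)))
    ≤⟨ ∑-mono-≤ 1 {n} (λ W → 𝟙*-mono-≤ (∣ W ∣ ≤? V) (λ ∣W∣≤V →
         ≤-trans (∑-small-subsets (within f W) j) (^-monoˡ-≤ j (s≤s (within≤K W ∣W∣≤V))))) ⟩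
  ∑ˢ {n} (λ W → 𝟙 (∣ W ∣ ≤? V) * suc K ^ j) ≡⟨ ∑-cong 1 {n} (λ W → *-comm (𝟙 (∣ W ∣ ≤? V)) (suc K ^ j)) ⟩
  ∑ˢ {n} (λ W → suc K ^ j * 𝟙 (∣ W ∣ ≤? V)) ≡⟨ ∑-*ˡ 1 {n} (suc K ^ j) (λ W → 𝟙 (∣ W ∣ ≤? V)) ⟩
  suc K ^ j * ∑ˢ {n} (λ W → 𝟙 (∣ W ∣ ≤? V)) ≤⟨ *-monoʳ-≤ (suc K ^ j) (∑-small-sets n V) ⟩
  suc K ^ j * suc n ^ V ≡⟨ *-comm (suc K ^ j) (suc n ^ V) ⟩
  suc n ^ V * suc K ^ j ∎
  where
  open ≤-Reasoning
  h : Subset n → Subset M → ℕ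
  h W b = 𝟙 (∣ W ∣ ≤? V) * 𝟙 (b ⊆? within f W ×-dec ∣ b ∣ ≤? j)
  via-union : ∀ b → 𝟙 (∣ ⋃ᶠ f b ∣ ≤? V ×-dec ∣ b ∣ ≤? j) ≤ ∑ˢ {n} (λ W → h W b)
  via-union b = 𝟙-≤ (∣ ⋃ᶠ f b ∣ ≤? V ×-dec ∣ b ∣ ≤? j) λ (∣U∣≤V , ∣b∣≤j) →
    ≤-trans (≤-reflexive (sym (cong₂ _*_ (𝟙-yes (∣ ⋃ᶠ f b ∣ ≤? V) ∣U∣≤V)
                                          (𝟙-yes (b ⊆? within f (⋃ᶠ f b) ×-dec ∣ b ∣ ≤? j)
                                                 ((λ i∈b → ∈within⁺ f (⊆⋃ᶠ f i∈b)) , ∣b∣≤j)))))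
            (∑-term 0 (λ W → h W b) (⋃ᶠ f b))

-- Binomial coefficients and r-subsets

binom : ℕ → ℕ → ℕ
binom _ zero = 1
binom zero (suc r) = 0
binom (suc n) (suc r) = binom n (suc r) + binom n r

combination : ∀ n r → Fin (binom n r) → Subset n
pascal : ∀ n r → Fin (binom n (suc r)) ⊎ Fin (binom n r) → Subset (suc n)

combination n zero _ = ⊥
combination (suc n) (suc r) = pascal n r ∘ splitAt (binom n (suc r))
pascal n r (inj₁ i) = outside ∷ combination n (suc r) i
pascal n r (inj₂ i) = inside ∷ combination n r i

∣combination∣ : ∀ n r i → ∣ combination n r i ∣ ≡ r
∣combination∣ n zero _ = ∣⊥∣≡0 n
∣combination∣ (suc n) (suc r) i = ∣pascal∣ (splitAt (binom n (suc r)) i)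
  where
  ∣pascal∣ : ∀ s → ∣ pascal n r s ∣ ≡ suc r
  ∣pascal∣ (inj₁ j) = ∣combination∣ n (suc r) j
  ∣pascal∣ (inj₂ j) = cong suc (∣combination∣ n r j)

combination-injective : ∀ n r {i j} → combination n r i ≡ combination n r j → i ≡ j
combination-injective n zero {zero} {zero} _ = refl
combination-injective (suc n) (suc r) {i} {j} eq = begin
  i ≡⟨ join-splitAt a b i ⟨
  join a b (splitAt a i) ≡⟨ cong (join a b) (pascal-injective (splitAt a i) (splitAt a j) eq) ⟩
  join a b (splitAt a j) ≡⟨ join-splitAt a b j ⟩
  j ∎
  where
  open ≡-Reasoning
  a = binom n (suc r)
  b = binom n r
  pascal-injective : ∀ s s′ → pascal n r s ≡ pascal n r s′ → s ≡ s′
  pascal-injective (inj₁ x) (inj₁ y) e = cong inj₁ (combination-injective n (suc r) (∷-injectiveʳ e))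
  pascal-injective (inj₂ x) (inj₂ y) e = cong inj₂ (combination-injective n r (∷-injectiveʳ e))
  pascal-injective (inj₁ x) (inj₂ y) e with ∷-injectiveˡ e
  ... | ()
  pascal-injective (inj₂ x) (inj₁ y) e with ∷-injectiveˡ e
  ... | ()

∣tabulate∣-+ : ∀ a b (g : Fin (a + b) → Bool) →
               ∣ tabulate g ∣ ≡ ∣ tabulate (g ∘ (_↑ˡ b)) ∣ + ∣ tabulate (g ∘ (a ↑ʳ_)) ∣
∣tabulate∣-+ zero b g = refl
∣tabulate∣-+ (suc a) b g with g zero
... | true = cong suc (∣tabulate∣-+ a b (g ∘ suc))
... | false = ∣tabulate∣-+ a b (g ∘ suc)

∣tabulate-outside∣ : ∀ m → ∣ tabulate {m} (λ _ → outside) ∣ ≡ 0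
∣tabulate-outside∣ zero = refl
∣tabulate-outside∣ (suc m) = ∣tabulate-outside∣ m

∣within-combination∣ : ∀ {n} r (W : Subset n) → ∣ within (combination n r) W ∣ ≡ binom (∣ W ∣) r
∣within-combination∣ zero W rewrite dec-true (⊥ ⊆? W) (⊆-min W) = refl
∣within-combination∣ {zero} (suc r) [] = refl
∣within-combination∣ {suc n} (suc r) (x ∷ W) = begin
  ∣ tabulate (inW ∘ splitAt a) ∣ ≡⟨ ∣tabulate∣-+ a b (inW ∘ splitAt a) ⟩
  ∣ tabulate (inW ∘ splitAt a ∘ (_↑ˡ b)) ∣ + ∣ tabulate (inW ∘ splitAt a ∘ (a ↑ʳ_)) ∣
    ≡⟨ cong₂ (λ p q → ∣ p ∣ + ∣ q ∣) (tabulate-cong (λ j → cong inW (splitAt-↑ˡ a j b)))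
                                     (tabulate-cong (λ j → cong inW (splitAt-↑ʳ a b j))) ⟩
  ∣ within (combination n (suc r)) W ∣ + ∣ tabulate (inW ∘ inj₂) ∣
    ≡⟨ cong₂ _+_ (∣within-combination∣ (suc r) W) (second x) ⟩
  binom (∣ W ∣) (suc r) + (if x then binom (∣ W ∣) r else 0)
    ≡⟨ pascal-rule x ⟩
  binom (∣ x ∷ W ∣) (suc r) ∎
  where
  open ≡-Reasoning
  a = binom n (suc r)
  b = binom n r
  inW : Fin a ⊎ Fin b → Bool
  inW s = does (pascal n r s ⊆? x ∷ W)
  second : ∀ x → ∣ tabulate (λ j → does (inside ∷ combination n r j ⊆? x ∷ W)) ∣ ≡ (if x then binom (∣ W ∣) r else 0)
  second inside = ∣within-combination∣ r W
  second outside = ∣tabulate-outside∣ b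
  pascal-rule : ∀ x → binom (∣ W ∣) (suc r) + (if x then binom (∣ W ∣) r else 0) ≡ binom (∣ x ∷ W ∣) (suc r)
  pascal-rule inside = refl
  pascal-rule outside = +-identityʳ _

binom-monoˡ-≤ : ∀ r {m n} → m ≤ n → binom m r ≤ binom n r
binom-monoˡ-≤ zero _ = ≤-refl
binom-monoˡ-≤ (suc r) z≤n = z≤n
binom-monoˡ-≤ (suc r) (s≤s m≤n) = +-mono-≤ (binom-monoˡ-≤ (suc r) m≤n) (binom-monoˡ-≤ r m≤n)

binom-pow : ∀ r s → s ^ r ≤ binom (r * s) r
binom-pow zero s = ≤-refl
binom-pow (suc r) s = ≤-trans (*-monoʳ-≤ s (binom-pow r s)) (pascal-iterated s (r * s))
  where
  pascal-iterated : ∀ s x → s * binom x r ≤ binom (s + x) (suc r)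
  pascal-iterated zero x = z≤n
  pascal-iterated (suc s) x = ≤-trans (≤-reflexive (+-comm (binom x r) (s * binom x r)))
    (+-mono-≤ (pascal-iterated s x) (binom-monoˡ-≤ r (m≤n+m x s)))

binom-lower : ∀ {n} r s → r * s ≤ n → s ^ r ≤ binom n r
binom-lower r s rs≤n = ≤-trans (binom-pow r s) (binom-monoˡ-≤ r rs≤n)

-- Sparse hypergraphs

spanBound : ℕ → ℕ → ℕ → ℕ
spanBound r k j = j * r ∸ k * (j ∸ 1) ∸ 1

Sparse : ∀ {n r} → Hypergraph n r → ℕ → ℕ → Set
Sparse {r = r} H k J =
  ∀ j → 1 ≤ j → j ≤ J → (S : Subset (m H)) → ∣ S ∣ ≡ j → ¬ (∣ unionOf H S ∣ ≤ spanBound r k j)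

sparse⇒small-intersections : ∀ {n r} (H : Hypergraph n r) {k J} → 2 ≤ J → Sparse H k J → SmallIntersections H k
sparse⇒small-intersections {r = r} H {k} 2≤J sparse e f e≢f with ∣ edge H e ∩ edge H f ∣ ≤? k
... | yes ∣A∩B∣≤k = ∣A∩B∣≤k
... | no ∣A∩B∣≰k = contradiction union-small (sparse 2 (s≤s z≤n) 2≤J (⁅ e ⁆ ∪ ⁅ f ⁆) (∣⁅x⁆∪⁅y⁆∣ e≢f))
  where
  A = edge H e
  B = edge H f
  ∣A∪B∣+1+k≤r+r : ∣ A ∪ B ∣ + 1 + k ≤ r + r
  ∣A∪B∣+1+k≤r+r = begin
    ∣ A ∪ B ∣ + 1 + k ≡⟨ +-assoc ∣ A ∪ B ∣ 1 k ⟩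
    ∣ A ∪ B ∣ + suc k ≤⟨ +-monoʳ-≤ ∣ A ∪ B ∣ (≰⇒> ∣A∩B∣≰k) ⟩
    ∣ A ∪ B ∣ + ∣ A ∩ B ∣ ≡⟨ ∣p∪q∣+∣p∩q∣ A B ⟩
    ∣ A ∣ + ∣ B ∣ ≡⟨ cong₂ _+_ (uniform H e) (uniform H f) ⟩
    r + r ∎
    where open ≤-Reasoning
  union-small : ∣ unionOf H (⁅ e ⁆ ∪ ⁅ f ⁆) ∣ ≤ spanBound r k 2
  union-small = begin
    ∣ ⋃ᶠ (edge H) (⁅ e ⁆ ∪ ⁅ f ⁆) ∣ ≡⟨ cong ∣_∣ (⋃ᶠ-⁅x⁆∪⁅y⁆ (edge H) e f) ⟩
    ∣ A ∪ B ∣ ≤⟨ m+n≤o⇒m≤o∸n ∣ A ∪ B ∣ (m+n≤o⇒m≤o∸n (∣ A ∪ B ∣ + 1) ∣A∪B∣+1+k≤r+r) ⟩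
    r + r ∸ k ∸ 1 ≡⟨ cong₂ (λ x y → x ∸ y ∸ 1) (cong (r +_) (+-identityʳ r)) (*-identityʳ k) ⟨
    spanBound r k 2 ∎
    where open ≤-Reasoning

Dense : ∀ n r k L → Pred (Subset (binom n r)) 0ℓ
Dense n r k L b = 1 ≤ ∣ b ∣ × ∣ b ∣ ≤ L × ∣ ⋃ᶠ (combination n r) b ∣ ≤ spanBound r k ∣ b ∣

dense? : ∀ n r k L → Decidable (Dense n r k L)
dense? n r k L b = 1 ≤? ∣ b ∣ ×-dec ∣ b ∣ ≤? L ×-dec ∣ ⋃ᶠ (combination n r) b ∣ ≤? spanBound r k ∣ b ∣

¬Dense⊥ : ∀ n r k L → ¬ Dense n r k L ⊥
¬Dense⊥ n r k L (0<∣⊥∣ , _) = <⇒≱ 0<∣⊥∣ (≤-reflexive (∣⊥∣≡0 (binom n r)))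

-- One r-set alone is never dense: it spans r > spanBound r k 1 = r ∸ 1 vertices.
dense⇒2≤∣b∣ : ∀ {n r k L b} → 0 < r → Dense n r k L b → 2 ≤ ∣ b ∣
dense⇒2≤∣b∣ {n} {r} {k} {L} {b} 0<r (1≤∣b∣ , _ , ∣U∣≤span) with 2 ≤? ∣ b ∣
... | yes 2≤∣b∣ = 2≤∣b∣
... | no 2≰∣b∣ = contradiction r≤r∸1 (<⇒≱ (∸-monoʳ-< {r} (s≤s z≤n) 0<r))
  where
  U = ⋃ᶠ (combination n r) b
  span₁ : spanBound r k ∣ b ∣ ≡ r ∸ 1
  span₁ rewrite ≤-antisym (≤-pred (≰⇒> 2≰∣b∣)) 1≤∣b∣ = cong₂ (λ x y → x ∸ y ∸ 1) (*-identityˡ r) (*-zeroʳ k)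
  r≤∣U∣ : r ≤ ∣ U ∣
  r≤∣U∣ with Nonempty⁺ b 1≤∣b∣
  ... | i , i∈b = subst (_≤ ∣ U ∣) (∣combination∣ n r i) (p⊆q⇒∣p∣≤∣q∣ (⊆⋃ᶠ (combination n r) i∈b))
  r≤r∸1 : r ≤ r ∸ 1
  r≤r∸1 = ≤-trans r≤∣U∣ (≤-trans ∣U∣≤span (≤-reflexive span₁))

hypergraph : ∀ n r → Subset (binom n r) → Hypergraph n r
hypergraph n r S = record
  { m = ∣ S ∣
  ; edge = combination n r ∘ nth S
  ; uniform = λ e → ∣combination∣ n r (nth S e)
  ; distinct = λ e f eq → nth-injective S (combination-injective n r eq)
  }

dense-free⇒sparse : ∀ n r k L (S : Subset (binom n r)) → (∀ b → Dense n r k L b → ¬ b ⊆ S) →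
                    Sparse (hypergraph n r S) k L
dense-free⇒sparse n r k L S free j 1≤j j≤L T ∣T∣≡j ∣U∣≤ = free (embed S T) dense (embed-⊆ S T)
  where
  ∣b∣≡j : ∣ embed S T ∣ ≡ j
  ∣b∣≡j = trans (∣embed∣ S T) ∣T∣≡j
  dense : Dense n r k L (embed S T)
  dense = subst (1 ≤_) (sym ∣b∣≡j) 1≤j
        , subst (_≤ L) (sym ∣b∣≡j) j≤L
        , subst₂ (λ U i → ∣ U ∣ ≤ spanBound r k i) (sym (⋃ᶠ-embed (combination n r) S T)) (sym ∣b∣≡j) ∣U∣≤

∑-dense-of-size : ∀ n r k L i → let V = spanBound r k (suc i) in
                  ∑ˢ (λ b → 𝟙 (dense? n r k L b ×-dec ∣ b ∣ ≟ suc i)) ≤ suc n ^ V * suc (binom V r) ^ suc i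
∑-dense-of-size n r k L i = ≤-trans
  (∑-mono-≤ 1 (λ b → 𝟙-mono (dense? n r k L b ×-dec ∣ b ∣ ≟ suc i)
                            (∣ ⋃ᶠ (combination n r) b ∣ ≤? V ×-dec ∣ b ∣ ≤? suc i) (small-union b)))
  (∑-small-union (combination n r) V (binom V r) (suc i) within≤)
  where
  V = spanBound r k (suc i)
  small-union : ∀ b → Dense n r k L b × ∣ b ∣ ≡ suc i → ∣ ⋃ᶠ (combination n r) b ∣ ≤ V × ∣ b ∣ ≤ suc i
  small-union b ((_ , _ , ∣U∣≤span) , ∣b∣≡) =
    subst (λ j → ∣ ⋃ᶠ (combination n r) b ∣ ≤ spanBound r k j) ∣b∣≡ ∣U∣≤span , ≤-reflexive ∣b∣≡
  within≤ : ∀ W → ∣ W ∣ ≤ V → ∣ within (combination n r) W ∣ ≤ binom V r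
  within≤ W ∣W∣≤V = ≤-trans (≤-reflexive (∣within-combination∣ r W)) (binom-monoˡ-≤ r ∣W∣≤V)

-- Arithmetic of the parameters

^-distribʳ-* : ∀ m n o → (m * n) ^ o ≡ m ^ o * n ^ o
^-distribʳ-* m n zero = refl
^-distribʳ-* m n (suc o) = trans (cong (m * n *_) (^-distribʳ-* m n o)) (interchange m n (m ^ o) (n ^ o))

1≤^ : ∀ {b} n → 1 ≤ b → 1 ≤ b ^ n
1≤^ {b} n 1≤b = m^n>0 b {{>-nonZero 1≤b}} n

1≤* : ∀ m n → 1 ≤ m → 1 ≤ n → 1 ≤ m * n
1≤* m n = *-mono-≤ {1} {m} {1} {n}

root : ∀ c .{{_ : NonZero c}} q n → ∃[ σ ] (c * σ ^ suc q ≤ n × n < c * suc σ ^ suc q)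
root c q zero = 0 , ≤-reflexive (*-zeroʳ c) , ≤-trans (>-nonZero⁻¹ c) (≤-reflexive (sym c*1^q≡c))
  where
  c*1^q≡c : c * 1 ^ suc q ≡ c
  c*1^q≡c = trans (cong (c *_) (^-zeroˡ (suc q))) (*-identityʳ c)
root c q (suc n) with root c q n
... | σ , lower , upper with suc n <? c * suc σ ^ suc q
...   | yes upper′ = σ , m≤n⇒m≤1+n lower , upper′
...   | no ¬upper′ = suc σ , ≤-reflexive boundary , subst (_< c * suc (suc σ) ^ suc q) boundary
                                                           (*-monoʳ-< c (^-monoˡ-< (suc q) (n<1+n (suc σ))))
  where
  boundary : c * suc σ ^ suc q ≡ suc n
  boundary = ≤-antisym (≮⇒≥ ¬upper′) upper

spanBound-suc : ∀ k e i → spanBound (suc (k + e)) k (suc i) ≡ k + e + i * suc e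
spanBound-suc k e i = begin
  suc i * suc (k + e) ∸ k * i ∸ 1 ≡⟨ cong (λ x → x ∸ k * i ∸ 1) (expand k e i) ⟩
  suc (k + e + i * suc e) + k * i ∸ k * i ∸ 1 ≡⟨ cong (_∸ 1) (m+n∸n≡m _ (k * i)) ⟩
  k + e + i * suc e ∎
  where
  open ≡-Reasoning
  expand : ∀ k e i → suc i * suc (k + e) ≡ suc (k + e + i * suc e) + k * i
  expand = solve-∀

-- With r = k + e + 1, q = s + 1, a = e + s (e + 1) and t = σ ^ a, this says that
-- σ ^ (q v) / t ^ (i + 1), for v = spanBound r k (i + 1), is at most σ ^ (q r) / t
-- divided by σ: dense families of i + 1 ≤ q sets are rarer than single sets.
exponent-gap : ∀ k e s i → i ≤ s →
               suc s * (k + e + i * suc e) + 1 ≤ (e + s * suc e) * i + suc s * suc (k + e)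
exponent-gap k e s i i≤s with m≤n⇒∃[o]m+o≡n i≤s
... | d , refl = ≤-trans (+-monoʳ-≤ _ (s≤s z≤n)) (≤-reflexive (sym (gap k e i d)))
  where
  gap : ∀ k e i d → (e + (i + d) * suc e) * i + suc (i + d) * suc (k + e)
                  ≡ suc (i + d) * (k + e + i * suc e) + suc d
  gap = solve-∀

power-bound : ∀ {n} P σ k q → 1 ≤ P → n ≤ P * σ ^ suc q →
              n ^ (k * suc q + 1) ≤ (P ^ suc k * σ ^ (k * suc q + 1)) ^ suc q
power-bound {n} P σ k q 1≤P n≤Pσ^Q = begin
  n ^ E ≤⟨ ^-monoˡ-≤ E n≤Pσ^Q ⟩
  (P * σ ^ Q) ^ E ≡⟨ ^-distribʳ-* P (σ ^ Q) E ⟩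
  P ^ E * (σ ^ Q) ^ E ≤⟨ *-monoˡ-≤ _ (^-monoʳ-≤ P {{>-nonZero 1≤P}} E≤) ⟩
  P ^ (suc k * Q) * (σ ^ Q) ^ E ≡⟨ cong₂ _*_ (sym (^-*-assoc P (suc k) Q)) swap-exponents ⟩
  (P ^ suc k) ^ Q * (σ ^ E) ^ Q ≡⟨ ^-distribʳ-* (P ^ suc k) (σ ^ E) Q ⟨
  (P ^ suc k * σ ^ E) ^ Q ∎
  where
  open ≤-Reasoning
  Q = suc q
  E = k * Q + 1
  E≤ : E ≤ suc k * Q
  E≤ = ≤-trans (≤-reflexive (+-comm (k * Q) 1)) (+-monoˡ-≤ (k * Q) (s≤s z≤n))
  swap-exponents : (σ ^ Q) ^ E ≡ (σ ^ E) ^ Q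
  swap-exponents = trans (^-*-assoc σ Q E) (trans (cong (σ ^_) (*-comm Q E)) (sym (^-*-assoc σ E Q)))

-- The construction

-- Write r = k + e + 1, q = J + 2 and σ = ⌊ (n / 2r) ^ (1 / q) ⌋, so n < M σ ^ q.
-- Each r-subset is kept with probability 1 / t, t = σ ^ a, and dense families of
-- up to q kept sets are destroyed; X = σ ^ (k q + 1) ≥ (n / M) ^ (k + 1 / q) edges
-- survive.  σ₀ absorbs the constant factors of the count of dense families; when
-- σ < σ₀, n < n₀ and a single edge is enough.
module Construction (k e J : ℕ) where

  r q a M V* σ₀ n₀ d : ℕ
  r = suc (k + e)
  q = suc (suc J)
  a = e + suc J * suc e
  M = 2 * r * 2 ^ q
  V* = k + e + suc J * suc e
  σ₀ = q * M ^ V* * suc (binom V* r) ^ q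
  n₀ = 2 * r * σ₀ ^ q
  d = (n₀ * M) ^ suc k

  1≤M : 1 ≤ M
  1≤M = 1≤* (2 * r) (2 ^ q) (s≤s z≤n) (1≤^ q (s≤s z≤n))

  1≤σ₀ : 1 ≤ σ₀
  1≤σ₀ = 1≤* (q * M ^ V*) _ (1≤* q (M ^ V*) (s≤s z≤n) (1≤^ V* 1≤M)) (1≤^ q (s≤s z≤n))

  1≤n₀ : 1 ≤ n₀
  1≤n₀ = 1≤* (2 * r) (σ₀ ^ q) (s≤s z≤n) (1≤^ q 1≤σ₀)

  1≤d : 1 ≤ d
  1≤d = 1≤^ (suc k) (1≤* n₀ M 1≤n₀ 1≤M)

  Good : ℕ → Set
  Good n = ∃[ H ] (ManyEdges {n} {r} H k 1 d 1 q × SmallIntersections H k × Sparse H k J)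

  dense-free⇒good : ∀ {n} (S : Subset (binom n r)) P σ → 1 ≤ P → P ≤ n₀ * M → n ≤ P * σ ^ q →
                    σ ^ (k * q + 1) ≤ ∣ S ∣ → (∀ b → Dense n r k q b → ¬ b ⊆ S) → Good n
  dense-free⇒good {n} S P σ 1≤P P≤n₀M n≤Pσ^q X≤∣S∣ free =
    H , many , sparse⇒small-intersections H (s≤s (s≤s z≤n)) sparse-q , sparse-J
    where
    H = hypergraph n r S
    sparse-q : Sparse H k q
    sparse-q = dense-free⇒sparse n r k q S free
    sparse-J : Sparse H k J
    sparse-J j 1≤j j≤J = sparse-q j 1≤j (≤-trans j≤J (m≤n+m J 2))
    many : ManyEdges H k 1 d 1 q
    many = begin
      1 ^ q * n ^ (k * q + 1) ≡⟨ trans (cong (_* n ^ (k * q + 1)) (^-zeroˡ q)) (*-identityˡ _) ⟩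
      n ^ (k * q + 1) ≤⟨ power-bound P σ k (suc J) 1≤P n≤Pσ^q ⟩
      (P ^ suc k * σ ^ (k * q + 1)) ^ q ≤⟨ ^-monoˡ-≤ q (*-mono-≤ (^-monoˡ-≤ (suc k) P≤n₀M) X≤∣S∣) ⟩
      (d * ∣ S ∣) ^ q ∎
      where open ≤-Reasoning

  module Large {n σ : ℕ} (σ₀≤σ : σ₀ ≤ σ) (lower : 2 * r * σ ^ q ≤ n) (upper : n < 2 * r * suc σ ^ q) where

    t X C : ℕ
    t = σ ^ a
    X = σ ^ (k * q + 1)
    C = t ^ suc J * σ ^ (q * r)

    1≤σ : 1 ≤ σ
    1≤σ = ≤-trans 1≤σ₀ σ₀≤σ

    n<Mσ^q : n < M * σ ^ q
    n<Mσ^q = begin-strict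
      n <⟨ upper ⟩
      2 * r * suc σ ^ q ≤⟨ *-monoʳ-≤ (2 * r) (^-monoˡ-≤ q 1+σ≤2σ) ⟩
      2 * r * (2 * σ) ^ q ≡⟨ cong (2 * r *_) (^-distribʳ-* 2 σ q) ⟩
      2 * r * (2 ^ q * σ ^ q) ≡⟨ *-assoc (2 * r) (2 ^ q) (σ ^ q) ⟨
      M * σ ^ q ∎
      where
      open ≤-Reasoning
      1+σ≤2σ : 1 + σ ≤ 2 * σ
      1+σ≤2σ = ≤-trans (+-monoˡ-≤ σ 1≤σ) (≤-reflexive (cong (σ +_) (sym (+-identityʳ σ))))

    2σ^qr≤binom : σ ^ (q * r) + σ ^ (q * r) ≤ binom n r
    2σ^qr≤binom = begin
      σ ^ (q * r) + σ ^ (q * r) ≡⟨ cong (σ ^ (q * r) +_) (+-identityʳ _) ⟨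
      2 * σ ^ (q * r) ≤⟨ *-monoˡ-≤ (σ ^ (q * r)) (*-monoʳ-≤ 2 (1≤^ (k + e) (s≤s z≤n))) ⟩
      2 ^ r * σ ^ (q * r) ≡⟨ cong (2 ^ r *_) (^-*-assoc σ q r) ⟨
      2 ^ r * (σ ^ q) ^ r ≡⟨ ^-distribʳ-* 2 (σ ^ q) r ⟨
      (2 * σ ^ q) ^ r ≤⟨ binom-lower r (2 * σ ^ q) (≤-trans (≤-reflexive r*2s≡2r*s) lower) ⟩
      binom n r ∎
      where
      open ≤-Reasoning
      r*2s≡2r*s : r * (2 * σ ^ q) ≡ 2 * r * σ ^ q
      r*2s≡2r*s = trans (x∙yz≈y∙xz r 2 (σ ^ q)) (sym (*-assoc 2 r (σ ^ q)))

    t^qX≡C : t ^ q * X ≡ C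
    t^qX≡C = begin
      t * t ^ suc J * X ≡⟨ trans (*-assoc t (t ^ suc J) X) (x∙yz≈y∙xz t (t ^ suc J) X) ⟩
      t ^ suc J * (t * X) ≡⟨ cong (t ^ suc J *_) (^-distribˡ-+-* σ a (k * q + 1)) ⟨
      t ^ suc J * σ ^ (a + (k * q + 1)) ≡⟨ cong (λ x → t ^ suc J * σ ^ x) (exponents k e J) ⟩
      C ∎
      where
      open ≡-Reasoning
      exponents : ∀ k e J → e + suc J * suc e + (k * suc (suc J) + 1) ≡ suc (suc J) * suc (k + e)
      exponents = solve-∀

    term≤C : ∀ i → i < q → let V = spanBound r k (suc i) in
             q * (t ^ (suc J ∸ i) * (suc n ^ V * suc (binom V r) ^ suc i)) ≤ C
    term≤C i i<q = begin
      q * (T * (suc n ^ spanBound r k (suc i) * suc (binom (spanBound r k (suc i)) r) ^ suc i))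
        ≡⟨ cong (λ V → q * (T * (suc n ^ V * suc (binom V r) ^ suc i))) (spanBound-suc k e i) ⟩
      q * (T * (suc n ^ V * K)) ≤⟨ *-monoʳ-≤ q (*-monoʳ-≤ T (*-monoˡ-≤ K (^-monoˡ-≤ V n<Mσ^q))) ⟩
      q * (T * ((M * σ ^ q) ^ V * K))
        ≡⟨ cong (λ x → q * (T * (x * K))) (trans (^-distribʳ-* M (σ ^ q) V) (cong (M ^ V *_) (^-*-assoc σ q V))) ⟩
      q * (T * (M ^ V * σ ^ (q * V) * K)) ≡⟨ regroup q T (M ^ V) (σ ^ (q * V)) K ⟩
      T * σ ^ (q * V) * (q * M ^ V * K) ≤⟨ *-monoʳ-≤ (T * σ ^ (q * V)) (≤-trans qM^VK≤σ₀ σ₀≤σ) ⟩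
      T * σ ^ (q * V) * σ ≡⟨ trans (*-assoc T _ σ) (cong (T *_) σ^qV*σ≡) ⟩
      T * σ ^ (q * V + 1) ≤⟨ *-monoʳ-≤ T (^-monoʳ-≤ σ {{>-nonZero 1≤σ}} (exponent-gap k e (suc J) i i≤sJ)) ⟩
      T * σ ^ (a * i + q * r) ≡⟨ cong (T *_) σ^[ai+qr]≡ ⟩
      T * (t ^ i * σ ^ (q * r)) ≡⟨ *-assoc T (t ^ i) _ ⟨
      T * t ^ i * σ ^ (q * r) ≡⟨ cong (_* σ ^ (q * r)) T*t^i≡ ⟩
      C ∎
      where
      open ≤-Reasoning
      T = t ^ (suc J ∸ i)
      V = k + e + i * suc e
      K = suc (binom V r) ^ suc i
      i≤sJ : i ≤ suc J
      i≤sJ = ≤-pred i<q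
      regroup : ∀ q T m s K → q * (T * (m * s * K)) ≡ T * s * (q * m * K)
      regroup = solve-∀
      V≤V* : V ≤ V*
      V≤V* = +-monoʳ-≤ (k + e) (*-monoˡ-≤ (suc e) i≤sJ)
      qM^VK≤σ₀ : q * M ^ V * K ≤ σ₀
      qM^VK≤σ₀ = *-mono-≤ (*-monoʳ-≤ q (^-monoʳ-≤ M {{>-nonZero 1≤M}} V≤V*))
                          (≤-trans (^-monoˡ-≤ (suc i) (s≤s (binom-monoˡ-≤ r V≤V*)))
                                   (^-monoʳ-≤ (suc (binom V* r)) i<q))
      σ^qV*σ≡ : σ ^ (q * V) * σ ≡ σ ^ (q * V + 1)
      σ^qV*σ≡ = trans (cong (σ ^ (q * V) *_) (sym (*-identityʳ σ))) (sym (^-distribˡ-+-* σ (q * V) 1))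
      σ^[ai+qr]≡ : σ ^ (a * i + q * r) ≡ t ^ i * σ ^ (q * r)
      σ^[ai+qr]≡ = trans (^-distribˡ-+-* σ (a * i) (q * r)) (cong (_* σ ^ (q * r)) (sym (^-*-assoc σ a i)))
      T*t^i≡ : T * t ^ i ≡ t ^ suc J
      T*t^i≡ = trans (sym (^-distribˡ-+-* t (suc J ∸ i) i)) (cong (t ^_) (m∸n+n≡m i≤sJ))

    dense-size : ∀ b → Dense n r k q b → 1 ≤ ∣ b ∣ × ∣ b ∣ ≤ q
    dense-size b (1≤∣b∣ , ∣b∣≤q , _) = 1≤∣b∣ , ∣b∣≤q

    expected-dense+X≤ : ∑ˢ (λ b → 𝟙 (dense? n r k q b) * t ^ (q ∸ ∣ b ∣)) + t ^ q * X ≤ t ^ suc J * binom n r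
    expected-dense+X≤ = begin
      ∑ˢ (λ b → 𝟙 (dense? n r k q b) * t ^ (q ∸ ∣ b ∣)) + t ^ q * X
        ≤⟨ +-monoˡ-≤ (t ^ q * X) (∑-by-size (dense? n r k q) q (λ s → t ^ (q ∸ s)) dense-size) ⟩
      ∑< q by-size + t ^ q * X ≤⟨ +-mono-≤ (∑<-≤ q by-size C by-size≤C) (≤-reflexive t^qX≡C) ⟩
      C + C ≡⟨ *-distribˡ-+ (t ^ suc J) _ _ ⟨
      t ^ suc J * (σ ^ (q * r) + σ ^ (q * r)) ≤⟨ *-monoʳ-≤ (t ^ suc J) 2σ^qr≤binom ⟩
      t ^ suc J * binom n r ∎
      where
      open ≤-Reasoning
      by-size : ℕ → ℕ
      by-size i = t ^ (suc J ∸ i) * ∑ˢ (λ b → 𝟙 (dense? n r k q b ×-dec ∣ b ∣ ≟ suc i))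
      by-size≤C : ∀ i → i < q → q * by-size i ≤ C
      by-size≤C i i<q = ≤-trans (*-monoʳ-≤ q (*-monoʳ-≤ (t ^ (suc J ∸ i)) (∑-dense-of-size n r k q i))) (term≤C i i<q)

    dense-free : ∃[ S ] (X ≤ ∣ S ∣ × (∀ b → Dense n r k q b → ¬ b ⊆ S))
    dense-free = alteration (pred t) (dense? n r k q) (suc J) (λ b → proj₂ ∘ dense-size b) (¬Dense⊥ n r k q) X
      (subst (λ t′ → ∑ˢ (λ b → 𝟙 (dense? n r k q b) * t′ ^ (q ∸ ∣ b ∣)) + t′ ^ q * X ≤ t′ ^ suc J * binom n r)
             (sym (suc-pred t {{m^n≢0 σ a {{>-nonZero 1≤σ}}}})) expected-dense+X≤)

    good : Good n
    good = dense-free⇒good S M σ 1≤M (m≤n*m M n₀ {{>-nonZero 1≤n₀}}) (<⇒≤ n<Mσ^q) X≤∣S∣ free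
      where
      S = proj₁ dense-free
      X≤∣S∣ = proj₁ (proj₂ dense-free)
      free = proj₂ (proj₂ dense-free)

  good-small : ∀ {n} → r < n → n < n₀ → Good n
  good-small {n} r<n n<n₀ = dense-free⇒good ⁅ i ⁆ n₀ 1 1≤n₀ (m≤m*n n₀ M {{>-nonZero 1≤M}}) n≤n₀*1^q 1^E≤1 free
    where
    0<binom : 0 < binom n r
    0<binom = ≤-trans (≤-reflexive (sym (^-zeroˡ r))) (binom-lower r 1 (≤-trans (≤-reflexive (*-identityʳ r)) (<⇒≤ r<n)))
    i : Fin (binom n r)
    i = fromℕ< 0<binom
    n≤n₀*1^q : n ≤ n₀ * 1 ^ q
    n≤n₀*1^q = ≤-trans (<⇒≤ n<n₀) (≤-reflexive (sym (trans (cong (n₀ *_) (^-zeroˡ q)) (*-identityʳ n₀))))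
    1^E≤1 : 1 ^ (k * q + 1) ≤ ∣ ⁅ i ⁆ ∣
    1^E≤1 = ≤-reflexive (trans (^-zeroˡ (k * q + 1)) (sym (∣⁅x⁆∣≡1 i)))
    free : ∀ b → Dense n r k q b → ¬ b ⊆ ⁅ i ⁆
    free b dense b⊆⁅i⁆ = <⇒≱ (dense⇒2≤∣b∣ {n} {r} {k} {q} {b} (s≤s z≤n) dense)
                             (≤-trans (p⊆q⇒∣p∣≤∣q∣ b⊆⁅i⁆) (≤-reflexive (∣⁅x⁆∣≡1 i)))

  -- The cases are split by helper functions rather than by with: with-abstraction
  -- over the goal Good n normalises the huge constant d and exhausts memory.
  good-all : ∀ n → r < n → Good n
  good-all n r<n = by-root (root (2 * r) (suc J) n)
    where
    by-root : ∃[ σ ] (2 * r * σ ^ q ≤ n × n < 2 * r * suc σ ^ q) → Good n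
    by-root (σ , lower , upper) = by-size (σ₀ ≤? σ)
      where
      by-size : Dec (σ₀ ≤ σ) → Good n
      by-size (yes σ₀≤σ) = Large.good σ₀≤σ lower upper
      by-size (no σ₀≰σ) = good-small r<n (≤-trans upper (*-monoʳ-≤ (2 * r) (^-monoˡ-≤ q (≰⇒> σ₀≰σ))))

lemma3p10 : (r k J : ℕ) → 2 ≤ k → k < r →
    ∃[ c ] ∃[ d ] ∃[ p ] ∃[ q ] (1 ≤ c × 1 ≤ d × 1 ≤ p × 1 ≤ q ×
    ((n : ℕ) → r < n → ∃[ H ] (ManyEdges {n} {r} H k c d p q
    × SmallIntersections H k
    × ((j : ℕ) → 1 ≤ j → j ≤ J → (S : Subset (Hypergraph.m H)) → ∣ S ∣ ≡ j →
    ¬ (∣ unionOf H S ∣ ≤ j * r ∸ k * (j ∸ 1) ∸ 1)))))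
lemma3p10 r k J _ k<r with m≤n⇒∃[o]m+o≡n k<r
... | e , refl = 1 , d , 1 , q , ≤-refl , 1≤d , ≤-refl , s≤s z≤n , good-all
  where open Construction k e J
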